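{- Let $\mathcal{V}$ be a quantaloid, $\mathbb{A}$ a $\mathcal{V}$-category and $\sim$ a bisimulation equivalence on $\mathbb{A}$. For $a,b\in\mathrm{Obj}(\mathbb{A})$ put $\tilde{\mathbb{A}}([a],[b])=\bigvee_{b'\sim b}\mathbb{A}(a,b')$ and $[a]_+=a_+$. Then $\tilde{\mathbb{A}}([a],[b])$ and $[a]_+$ do not depend on the chosen representatives, this makes the quotient set $\mathrm{Obj}(\mathbb{A})/\!\sim$ into a $\mathcal{V}$-category $\tilde{\mathbb{A}}$, and the quotient map $a\mapsto[a]$ is a $\mathcal{V}$-functor $\mathbb{A}\to\tilde{\mathbb{A}}$.
   Context: A quantaloid $\mathcal{V}$ is a small, locally ordered bicategory whose hom-posets $\mathcal{V}(u,v)$ are complete lattices and which is biclosed (for every arrow $f$, $-\otimes f$ and $f\otimes -$ have right adjoints, $\otimes$ being horizontal composition in diagrammatic order); in particular $\otimes$ preserves arbitrary joins in each variable. A $\mathcal{V}$-category $\mathbb{A}$ consists of a set $\mathrm{Obj}(\mathbb{A})$, a map $a\mapsto a_+$ from $\mathrm{Obj}(\mathbb{A})$ to $\mathrm{Obj}(\mathcal{V})$, and arrows $\mathbb{A}(a,b):a_+\to b_+$ of $\mathcal{V}$ with $id_{a_+}\le\mathbb{A}(a,a)$ and $\mathbb{A}(a,b)\otimes\mathbb{A}(b,c)\le\mathbb{A}(a,c)$. A $\mathcal{V}$-functor $f:\mathbb{A}\to\mathbb{B}$ is a map $f:\mathrm{Obj}(\mathbb{A})\to\mathrm{Obj}(\mathbb{B})$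 with $(fa)_+=a_+$ and $\mathbb{A}(a,a')\le\mathbb{B}(fa,fa')$. A simulation from $\mathbb{A}$ to $\mathbb{B}$ is a relation $R\subseteq\mathrm{Obj}(\mathbb{A})\times\mathrm{Obj}(\mathbb{B})$ with $(a,b)\in R\Rightarrow a_+=b_+$ and, for all $(a,b)\in R$ and $a'$, $\mathbb{A}(a,a')\le\bigvee_{b':(a',b')\in R}\mathbb{B}(b,b')$; a bisimulation is a relation $R$ such that $R$ and $R^{ -1}$ are simulations. A bisimulation equivalence on $\mathbb{A}$ is an equivalence relation on $\mathrm{Obj}(\mathbb{A})$ that is a bisimulation from $\mathbb{A}$ to $\mathbb{A}$. -}

module Defs where

open import Level using (Level; _⊔_; suc)
open import Data.Product using (Σ; _,_; proj₁; proj₂)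
open import Relation.Binary.PropositionalEquality using (_≡_; refl; subst₂; sym)
open import Relation.Binary.Structures using (IsPartialOrder)
open import Relation.Binary.Core using (Rel)

-- Composition _⊗_ is in diagrammatic order.
-- Being locally ordered, the bicategory coherence isomorphisms are
-- equalities (isomorphism in a poset is equality).
record Quantaloid (o h r ι : Level) : Set (suc (o ⊔ h ⊔ r ⊔ ι)) where
  infixr 7 _⊗_
  infix 4 _≤_
  field
    Obj   : Set o
    Hom   : Obj → Obj → Set h
    _≤_   : ∀ {u v} → Hom u v → Hom u v → Set r
    isPartialOrder : ∀ {u v} → IsPartialOrder (_≡_ {A = Hom u v}) _≤_
    _⊗_   : ∀ {u v w} → Hom u v → Hom v w → Hom u w
    id    : ∀ u → Hom u u
    ⊗-mono : ∀ {u v w} {f f' : Hom u v} {g g' : Hom v w} →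
             f ≤ f' → g ≤ g' → f ⊗ g ≤ f' ⊗ g'
    assoc : ∀ {u v w x} (f : Hom u v) (g : Hom v w) (k : Hom w x) →
            (f ⊗ g) ⊗ k ≡ f ⊗ (g ⊗ k)
    idˡ   : ∀ {u v} (f : Hom u v) → id u ⊗ f ≡ f
    idʳ   : ∀ {u v} (f : Hom u v) → f ⊗ id v ≡ f
    ⋁     : ∀ {u v} {I : Set ι} → (I → Hom u v) → Hom u v
    ⋁-upper : ∀ {u v} {I : Set ι} (F : I → Hom u v) (i : I) → F i ≤ ⋁ F
    ⋁-least : ∀ {u v} {I : Set ι} (F : I → Hom u v) (g : Hom u v) →
              (∀ i → F i ≤ g) → ⋁ F ≤ g
    _◁_   : ∀ {u v w} → Hom u w → Hom v w → Hom u v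
    ◁-adj₁ : ∀ {u v w} {g : Hom u v} {f : Hom v w} {k : Hom u w} →
             g ⊗ f ≤ k → g ≤ k ◁ f
    ◁-adj₂ : ∀ {u v w} {g : Hom u v} {f : Hom v w} {k : Hom u w} →
             g ≤ k ◁ f → g ⊗ f ≤ k
    _▷_   : ∀ {u v w} → Hom u v → Hom u w → Hom v w
    ▷-adj₁ : ∀ {u v w} {f : Hom u v} {g : Hom v w} {k : Hom u w} →
             f ⊗ g ≤ k → g ≤ f ▷ k
    ▷-adj₂ : ∀ {u v w} {f : Hom u v} {g : Hom v w} {k : Hom u w} →
             g ≤ f ▷ k → f ⊗ g ≤ k

module _ {o h r ι : Level} (V : Quantaloid o h r ι) where
  open Quantaloid V

  cast : ∀ {u u' v v'} → u ≡ u' → v ≡ v' → Hom u v → Hom u' v'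
  cast p q f = subst₂ Hom p q f

  record VCategory : Set (o ⊔ h ⊔ r ⊔ suc ι) where
    field
      Ob    : Set ι
      _₊    : Ob → Obj
      hom   : (a b : Ob) → Hom (a ₊) (b ₊)
      hom-id   : ∀ a → id (a ₊) ≤ hom a a
      hom-comp : ∀ a b c → hom a b ⊗ hom b c ≤ hom a c

  record IsVCategory {Ob : Set ι} (_₊ : Ob → Obj)
                     (hom : (a b : Ob) → Hom (a ₊) (b ₊)) : Set (ι ⊔ r) where
    field
      hom-id   : ∀ a → id (a ₊) ≤ hom a a
      hom-comp : ∀ a b c → hom a b ⊗ hom b c ≤ hom a c

  record IsSimulation (A B : VCategory) (R : VCategory.Ob A → VCategory.Ob B → Set ι)
                      : Set (o ⊔ r ⊔ ι) where
    open VCategory A renaming (_₊ to _₊ᴬ; hom to homᴬ)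
    open VCategory B renaming (_₊ to _₊ᴮ; hom to homᴮ)
    field
      sorts : ∀ {a b} → R a b → a ₊ᴬ ≡ b ₊ᴮ
      simulate : ∀ {a b} (r : R a b) (a' : VCategory.Ob A) →
        homᴬ a a' ≤ ⋁ {I = Σ (VCategory.Ob B) (λ b' → R a' b')}
                       (λ { (b' , r') → cast (sym (sorts r)) (sym (sorts r')) (homᴮ b b') })

  record IsBisimulation (A B : VCategory) (R : VCategory.Ob A → VCategory.Ob B → Set ι)
                        : Set (o ⊔ r ⊔ ι) where
    field
      fwd : IsSimulation A B R
      bwd : IsSimulation B A (λ b a → R a b)

  IsVFunctorData : {ObA ObB : Set ι} (_₊ᴬ : ObA → Obj) (_₊ᴮ : ObB → Obj)
                   (homᴬ : (a b : ObA) → Hom (a ₊ᴬ) (b ₊ᴬ))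
                   (homᴮ : (a b : ObB) → Hom (a ₊ᴮ) (b ₊ᴮ))
                   (f : ObA → ObB) (pres : ∀ a → f a ₊ᴮ ≡ a ₊ᴬ) → Set (ι ⊔ r)
  IsVFunctorData _₊ᴬ _₊ᴮ homᴬ homᴮ f pres =
    ∀ a a' → homᴬ a a' ≤ cast (pres a) (pres a') (homᴮ (f a) (f a'))

  -- the quotient hom  Ã([a],[b]) = ⋁_{b' ∼ b} A(a,b')  on representatives;
  -- the sort equality b'₊ ≡ b₊ comes from ∼ being a simulation
  module _ (A : VCategory) (_∼_ : VCategory.Ob A → VCategory.Ob A → Set ι)
           (sorts : ∀ {a b} → a ∼ b → VCategory._₊ A a ≡ VCategory._₊ A b) where
    open VCategory A
    quotHom : (a b : Ob) → Hom (a ₊) (b ₊)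
    quotHom a b = ⋁ {I = Σ Ob (λ b' → b' ∼ b)}
                    (λ { (b' , r) → cast refl (sorts r) (hom a b') })

{-# OPTIONS --with-K #-}
module Submission where

-- Because ∼ is symmetric, the forward simulation condition alone gives, for
-- a ∼ a' and b ∼ c,  A(a,b) ≤ ⋁_{b ∼ d} A(a',d) ≤ Ã(a',c).  Taking joins yields
-- independence of representatives.  For composition, change the representative
-- of [b] so that each summand of Ã(a,b) ⊗ Ã(b,c) becomes A(a,b') ⊗ Ã(b',c), which
-- is below Ã(a,c) because ⊗ distributes over joins.  The casts along the sort
-- equalities are coherent by UIP, which is why K is needed.

open import Defs
open import Level using (Level)
open import Data.Product using (_×_; _,_)
open import Relation.Binary.PropositionalEquality using (_≡_; refl; sym; trans; cong)
open import Relation.Binary.Structures using (IsEquivalence; IsPartialOrder)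
open import Relation.Binary.Bundles using (Poset)
import Relation.Binary.Reasoning.PartialOrder as PosetReasoning

module QuantaloidProperties {o h r ι : Level} (V : Quantaloid o h r ι) where
  open Quantaloid V

  module ≤ {u v} = IsPartialOrder (isPartialOrder {u} {v})

  homPoset : Obj → Obj → Poset h h r
  homPoset u v = record { isPartialOrder = isPartialOrder {u} {v} }

  ⊗-distribʳ-⋁ : ∀ {u v w} {I : Set ι} (F : I → Hom u v) (g : Hom v w) →
                 ⋁ F ⊗ g ≡ ⋁ (λ i → F i ⊗ g)
  ⊗-distribʳ-⋁ F g = ≤.antisym
    (◁-adj₂ (⋁-least F _ (λ i → ◁-adj₁ (⋁-upper (λ j → F j ⊗ g) i))))
    (⋁-least _ _ (λ i → ⊗-mono (⋁-upper F i) ≤.refl))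

  ⊗-distribˡ-⋁ : ∀ {u v w} {I : Set ι} (f : Hom u v) (G : I → Hom v w) →
                 f ⊗ ⋁ G ≡ ⋁ (λ i → f ⊗ G i)
  ⊗-distribˡ-⋁ f G = ≤.antisym
    (▷-adj₂ (⋁-least G _ (λ i → ▷-adj₁ (⋁-upper (λ j → f ⊗ G j) i))))
    (⋁-least _ _ (λ i → ⊗-mono ≤.refl (⋁-upper G i)))

  cast-cast : ∀ {u u' u'' v v' v''}
              (p : u' ≡ u'') (q : v' ≡ v'') (p' : u ≡ u') (q' : v ≡ v')
              (p'' : u ≡ u'') (q'' : v ≡ v'') (f : Hom u v) →
              cast V p q (cast V p' q' f) ≡ cast V p'' q'' f
  cast-cast refl refl refl refl refl refl f = refl

  cast-irrelevant : ∀ {u u' v v'} (p p' : u ≡ u') (q q' : v ≡ v') (f : Hom u v) →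
                    cast V p q f ≡ cast V p' q' f
  cast-irrelevant p p' q q' = cast-cast refl refl p q p' q'

  cast-id : ∀ {u v} (p : u ≡ u) (q : v ≡ v) (f : Hom u v) → cast V p q f ≡ f
  cast-id p q = cast-cast p q refl refl refl refl

  cast-mono : ∀ {u u' v v'} (p : u ≡ u') (q : v ≡ v') {f g : Hom u v} →
              f ≤ g → cast V p q f ≤ cast V p q g
  cast-mono refl refl f≤g = f≤g

  cast-⋁ : ∀ {u u' v v'} (p : u ≡ u') (q : v ≡ v') {I : Set ι} (F : I → Hom u v) →
           cast V p q (⋁ F) ≡ ⋁ (λ i → cast V p q (F i))
  cast-⋁ refl refl F = refl

  cast-⊗ : ∀ {u u' v v' w w'} (p : u ≡ u') (q : v ≡ v') (k : w ≡ w')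
           (f : Hom u v) (g : Hom v w) → cast V p q f ⊗ cast V q k g ≡ cast V p k (f ⊗ g)
  cast-⊗ refl refl refl f g = refl

module QuotientBySimulationEquivalence
  {o h r ι : Level} (V : Quantaloid o h r ι) (A : VCategory V)
  (_∼_ : VCategory.Ob A → VCategory.Ob A → Set ι) (∼-equiv : IsEquivalence _∼_)
  (sim : IsSimulation V A A _∼_) where

  open Quantaloid V
  open QuantaloidProperties V
  open VCategory A
  open IsSimulation sim
  module ∼ = IsEquivalence ∼-equiv

  Ã : (a b : Ob) → Hom (a ₊) (b ₊)
  Ã = quotHom V A _∼_ sorts

  hom≤quotHom : ∀ {a b c} (r : b ∼ c) (e : b ₊ ≡ c ₊) → cast V refl e (hom a b) ≤ Ã a c
  hom≤quotHom {a} {b} r e =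
    ≤.trans (≤.reflexive (cast-irrelevant refl refl e (sorts r) (hom a b))) (⋁-upper _ (b , r))

  hom≤quotHom-simulate : ∀ {a a' b c} (p : a ∼ a') (r : b ∼ c)
                         (e₁ : a ₊ ≡ a' ₊) (e₂ : b ₊ ≡ c ₊) → cast V e₁ e₂ (hom a b) ≤ Ã a' c
  hom≤quotHom-simulate {a' = a'} {b} {c} p r e₁ e₂ =
    ≤.trans (cast-mono e₁ e₂ (simulate p b))
      (≤.trans (≤.reflexive (cast-⋁ e₁ e₂ _)) (⋁-least _ _ (λ (_ , t) → bound t)))
    where
    bound : ∀ {d} (t : b ∼ d) →
            cast V e₁ e₂ (cast V (sym (sorts p)) (sym (sorts t)) (hom a' d)) ≤ Ã a' c
    bound {d} t = ≤.trans
      (≤.reflexive (cast-cast e₁ e₂ _ _ refl (trans (sym (sorts t)) e₂) (hom a' d)))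
      (hom≤quotHom (∼.trans (∼.sym t) r) _)

  quotHom-resp-≤ : ∀ {a a' b b'} (p : a ∼ a') (q : b ∼ b') →
                 cast V (sorts p) (sorts q) (Ã a b) ≤ Ã a' b'
  quotHom-resp-≤ {a} p q =
    ≤.trans (≤.reflexive (cast-⋁ (sorts p) (sorts q) _))
      (⋁-least _ _ (λ (b'' , r) → ≤.trans
        (≤.reflexive (cast-cast (sorts p) (sorts q) refl (sorts r)
                                (sorts p) (trans (sorts r) (sorts q)) (hom a b'')))
        (hom≤quotHom-simulate p (∼.trans r q) _ _)))

  quotHom-resp : ∀ {a a' b b'} (p : a ∼ a') (q : b ∼ b') →
                 cast V (sorts p) (sorts q) (Ã a b) ≡ Ã a' b'
  quotHom-resp {a} {a'} {b} {b'} p q = ≤.antisym (quotHom-resp-≤ p q) (begin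
    Ã a' b'
      ≡⟨ sym (cast-cast (sorts p) (sorts q) (sorts (∼.sym p)) (sorts (∼.sym q)) refl refl _) ⟩
    cast V (sorts p) (sorts q) (cast V (sorts (∼.sym p)) (sorts (∼.sym q)) (Ã a' b'))
      ≤⟨ cast-mono (sorts p) (sorts q) (quotHom-resp-≤ (∼.sym p) (∼.sym q)) ⟩
    cast V (sorts p) (sorts q) (Ã a b) ∎)
    where open PosetReasoning (homPoset _ _)

  quotientFunctor : IsVFunctorData V _₊ _₊ hom Ã (λ a → a) (λ a → refl)
  quotientFunctor a b = hom≤quotHom ∼.refl refl

  hom⊗quotHom≤quotHom : ∀ a b c → hom a b ⊗ Ã b c ≤ Ã a c
  hom⊗quotHom≤quotHom a b c =
    ≤.trans (≤.reflexive (⊗-distribˡ-⋁ (hom a b) _)) (⋁-least _ _ (λ (_ , t) → bound t))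
    where
    open PosetReasoning (homPoset _ _)
    bound : ∀ {c'} (t : c' ∼ c) → hom a b ⊗ cast V refl (sorts t) (hom b c') ≤ Ã a c
    bound {c'} t = begin
      hom a b ⊗ cast V refl (sorts t) (hom b c') ≡⟨ cast-⊗ refl refl (sorts t) _ _ ⟩
      cast V refl (sorts t) (hom a b ⊗ hom b c') ≤⟨ cast-mono refl (sorts t) (hom-comp a b c') ⟩
      cast V refl (sorts t) (hom a c')           ≤⟨ hom≤quotHom t (sorts t) ⟩
      Ã a c ∎

  quotHom-comp : ∀ a b c → Ã a b ⊗ Ã b c ≤ Ã a c
  quotHom-comp a b c =
    ≤.trans (≤.reflexive (⊗-distribʳ-⋁ _ (Ã b c))) (⋁-least _ _ (λ (_ , r) → bound r))
    where
    open PosetReasoning (homPoset _ _)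
    bound : ∀ {b'} (r : b' ∼ b) → cast V refl (sorts r) (hom a b') ⊗ Ã b c ≤ Ã a c
    bound {b'} r = begin
      cast V refl (sorts r) (hom a b') ⊗ Ã b c
        ≡⟨ cong (cast V refl (sorts r) (hom a b') ⊗_) (sym (quotHom-resp r ∼.refl)) ⟩
      cast V refl (sorts r) (hom a b') ⊗ cast V (sorts r) (sorts ∼.refl) (Ã b' c)
        ≡⟨ cast-⊗ refl (sorts r) (sorts ∼.refl) _ _ ⟩
      cast V refl (sorts ∼.refl) (hom a b' ⊗ Ã b' c)
        ≡⟨ cast-id refl (sorts ∼.refl) _ ⟩
      hom a b' ⊗ Ã b' c
        ≤⟨ hom⊗quotHom≤quotHom a b' c ⟩
      Ã a c ∎

  isVCategory : IsVCategory V _₊ Ã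
  isVCategory = record
    { hom-id   = λ a → ≤.trans (hom-id a) (quotientFunctor a a)
    ; hom-comp = quotHom-comp
    }

mainTheorem4 : {o h r ι : Level} (V : Quantaloid o h r ι) (A : VCategory V)
    (_∼_ : VCategory.Ob A → VCategory.Ob A → Set ι) →
    IsEquivalence _∼_ →
    (bis : IsBisimulation V A A _∼_) →
    let open Quantaloid V
        open VCategory A
        sorts = IsSimulation.sorts (IsBisimulation.fwd bis)
        Ã = quotHom V A _∼_ sorts
    in
    -- [a]₊ = a₊ does not depend on the representative
    (∀ {a a'} → a ∼ a' → a ₊ ≡ a' ₊)
    -- Ã([a],[b]) does not depend on the representatives
    × (∀ {a a' b b'} (p : a ∼ a') (q : b ∼ b') →
         cast V (sorts p) (sorts q) (Ã a b) ≡ Ã a' b')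
    -- Ã is a V-category
    × IsVCategory V _₊ Ã
    -- the quotient map a ↦ [a] is a V-functor A → Ã
    × IsVFunctorData V _₊ _₊ hom Ã (λ a → a) (λ a → refl)
mainTheorem4 V A _∼_ ∼-equiv bis = sorts , quotHom-resp , isVCategory , quotientFunctor
  where
  open IsSimulation (IsBisimulation.fwd bis) using (sorts)
  open QuotientBySimulationEquivalence V A _∼_ ∼-equiv (IsBisimulation.fwd bis)
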